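{- Let $U=\{u_1,\dots,u_{3n}\}$ and $\mathcal{S}=\{S_1,\dots,S_p\}$ be a family of $3$-element subsets of $U$, with $n,p\ge1$, and let $m\ge 6n+3p$ be an integer. Let $G$ be the labeled complete bipartite graph with partite sets $V_1,V_2$ and tolerances $t$ on $V_1$ constructed as in the context, and suppose $G$ has a one-sided $t$-perfect clustering $\mathcal{C}$. Then for every $u_j\in U$ there is a unique $S_i\in\mathcal{S}$ such that $x_j$ is in the same cluster as $x(S_i)$; moreover (1) $u_j\in S_i$, and (2) $x_j$ is in the same cluster as every vertex $y_\ell$ with $u_\ell\in S_i$.
   Context: Construction: For each $u_i\in U$ there are ground vertices $x_i\in V_1$, $y_i\in V_2$; the edge $x_iy_j$ is $+$ if $i=j$ or $u_i,u_j$ lie in a common set of $\mathcal{S}$, and $-$ otherwise. For each $S_i\in\mathcal{S}$ there are triplet vertices $x(S_i)\in V_1$ and $y_1(S_i),\dots,y_m(S_i)\in V_2$; edges $x(S_i)y_k(S_i)$ are $+$, and edges $x(S_i)y_k(S_\ell)$ with $i\ne\ell$ are $-$. For $u_i\in U$ and $S_j\in\mathcal{S}$, the edges $x_iy_k(S_j)$ (all $k$) and $y_ix(S_j)$ are $+$ if $u_i\in S_j$ and $-$ otherwise. There are dummy vertices $Z=\{z_1,\dots,z_{3n}\}\subseteq V_2$, joined by $+$ edges to all $x_i$ and by $-$ edges to all $x(S_j)$. Tolerances: $t_{x(S_i)}=3$; for $u_i\in U$, with $d(u_i)$ the number of sets of $\mathcal{S}$ containing $u_i$ and $c(u_i)$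 the number of $u_j\ne u_i$ lying in a common set of $\mathcal{S}$ with $u_i$, $t_{x_i}=m(d(u_i)-1)+(c(u_i)-2)+(|Z|-3)$. A clustering is a partition of $V_1\cup V_2$; an error is a $+$ edge between clusters or a $-$ edge within a cluster; a clustering is one-sided $t$-perfect if every $v\in V_1$ is incident to at most $t_v$ errors. -}

module Defs where

open import Data.Nat using (ℕ; _*_; _≡ᵇ_)
import Data.Nat as ℕ
open import Data.Integer as ℤ using (ℤ; +_)
open import Data.Bool using (Bool; true; false; if_then_else_; not; _∧_; _∨_)
open import Data.Fin using (Fin; _≟_)
open import Data.Fin.Properties using (any?)
open import Data.Fin.Subset using (Subset; _∈_)
open import Data.Fin.Subset.Properties using (_∈?_)
open import Data.List using (List; []; _∷_; _++_; map; concatMap; length; filter; allFin)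
open import Data.Nat.ListAction using (sum)
open import Data.Product using (∃; _×_)
open import Data.Product.Properties using ()
open import Data.Sum using (_⊎_; inj₁; inj₂)
open import Relation.Nullary using (¬_; ¬?; Dec)
open import Relation.Nullary.Decidable using (⌊_⌋; _×-dec_)

-- The construction of the paper, for a ground set U = {u_0,…,u_{3n-1}} (indexed by Fin (3 * n)),
-- a family S_0,…,S_{p-1} of subsets of U (S : Fin p → Subset (3 * n)) and the integer m.
module Construction (n p m : ℕ) (S : Fin p → Subset (3 * n)) where

  data V₁ : Set where
    x  : Fin (3 * n) → V₁
    xS : Fin p → V₁

  data V₂ : Set where
    y  : Fin (3 * n) → V₂
    yS : Fin p → Fin m → V₂
    z  : Fin (3 * n) → V₂

  allV₂ : List V₂
  allV₂ = map y (allFin (3 * n))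
       ++ concatMap (λ i → map (yS i) (allFin m)) (allFin p)
       ++ map z (allFin (3 * n))

  Common : Fin (3 * n) → Fin (3 * n) → Set
  Common i j = ∃ λ l → i ∈ S l × j ∈ S l

  common? : ∀ i j → Dec (Common i j)
  common? i j = any? (λ l → (i ∈? S l) ×-dec (j ∈? S l))

  mem : Fin (3 * n) → Fin p → Bool
  mem i l = ⌊ i ∈? S l ⌋

  -- sign of the edge v w of the complete bipartite graph (true = '+', false = '-')
  sign : V₁ → V₂ → Bool
  sign (x i)  (y j)    = ⌊ i ≟ j ⌋ ∨ ⌊ common? i j ⌋
  sign (x i)  (yS j k) = mem i j
  sign (x i)  (z _)    = true
  sign (xS j) (y i)    = mem i j
  sign (xS i) (yS l k) = ⌊ i ≟ l ⌋
  sign (xS i) (z _)    = false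

  deg : Fin (3 * n) → ℕ
  deg i = length (filter (λ l → i ∈? S l) (allFin p))

  cnb : Fin (3 * n) → ℕ
  cnb i = length (filter (λ j → ¬? (j ≟ i) ×-dec common? i j) (allFin (3 * n)))

  -- tolerances (integer-valued, since e.g. d(u_i) - 1 may be negative)
  tol : V₁ → ℤ
  tol (xS _) = + 3
  tol (x i)  = (+ m ℤ.* (+ deg i ℤ.- + 1)) ℤ.+ (+ cnb i ℤ.- + 2) ℤ.+ (+ (3 * n) ℤ.- + 3)

  -- a clustering: a partition of V₁ ∪ V₂, given by a cluster label for every vertex
  Clustering : Set
  Clustering = V₁ ⊎ V₂ → ℕ

  sameᵇ : Clustering → V₁ → V₂ → Bool
  sameᵇ cl v w = cl (inj₁ v) ≡ᵇ cl (inj₂ w)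

  isError : Clustering → V₁ → V₂ → Bool
  isError cl v w = (sign v w ∧ not (sameᵇ cl v w)) ∨ (not (sign v w) ∧ sameᵇ cl v w)

  errors : Clustering → V₁ → ℕ
  errors cl v = sum (map (λ w → if isError cl v w then 1 else 0) allV₂)

  OneSidedPerfect : Clustering → Set
  OneSidedPerfect cl = ∀ v → + errors cl v ℤ.≤ tol v

module Submission where

-- Every error count is a sum over V₂ of edge indicators, so the proof is double counting.
-- Two vertices of V₁ are compared edge by edge (three Boolean facts: same cluster, different
-- clusters, common positive neighbour outside a common cluster), and the sums over V₂ are
-- split into the ground vertices y, the m-vertex triplet blocks y_k(S_l) and the dummies Z.
--   (a) Two triplet vertices in one cluster disagree on the m vertices of a block, which
--       costs them m > 6 errors although each tolerates only 3: uniqueness.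
--   (b) If x_j missed the clusters of all x(S_l) with u_j ∈ S_l, each of its d(u_j) blocks
--       would cost it m - 3 errors, beyond its tolerance as m ≥ 6n + 3p: existence and (1).
--   (c) If x_j and x(S_i) share a cluster avoiding some y_ℓ with u_ℓ ∈ S_i, comparing their
--       positive degrees shows two errors more than the tolerances allow: (2).

open import Algebra.Properties.CommutativeSemigroup using (interchange)
open import Data.Bool using (Bool; true; false; T; not; _∧_; _∨_; if_then_else_)
open import Data.Bool.Properties using (∨-zeroʳ)
open import Data.Empty using (⊥; ⊥-elim)
open import Data.Fin using (Fin; zero; suc)
import Data.Fin as Fin
open import Data.Fin.Properties using (any?)
open import Data.Fin.Subset using (Subset; _∈_; ∣_∣; inside; outside)
open import Data.Fin.Subset.Properties using (_∈?_)
open import Data.Integer as ℤ using (ℤ)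
import Data.Integer.Properties as ℤP
import Data.Integer.Tactic.RingSolver as ℤSolver
open import Data.List using (List; []; _∷_; _++_; map; concatMap; length; filter; allFin)
open import Data.List.Properties using (map-++; map-∘; map-tabulate; length-tabulate; length-filter)
open import Data.List.Membership.Propositional using () renaming (_∈_ to _∈ₗ_)
open import Data.List.Membership.Propositional.Properties using (∈-map⁺; ∈-++⁺ˡ; ∈-allFin)
open import Data.List.Relation.Unary.Any using (here; there)
open import Data.Nat
open import Data.Nat.ListAction using (sum)
open import Data.Nat.ListAction.Properties using (sum-++)
open import Data.Nat.Properties
import Data.Nat.Tactic.RingSolver as ℕSolver
open import Data.Product using (Σ; _×_; _,_; proj₁; proj₂)
open import Data.Sum using (inj₁; inj₂)
open import Data.Unit using (tt)
open import Data.Vec using ([]; _∷_)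
open import Function using (_∘_)
open import Function.Definitions using (Injective)
open import Level using (0ℓ)
open import Relation.Nullary using (Dec; yes; no; does; ¬_; ¬?)
open import Relation.Nullary.Decidable using (⌊_⌋; isYes≗does; dec-true; dec-false; toWitness; _×-dec_)
open import Relation.Unary using (Pred; Decidable)
open import Relation.Binary.PropositionalEquality
open import Defs

𝟙 : Bool → ℕ
𝟙 b = if b then 1 else 0

∑ : {A : Set} → List A → (A → ℕ) → ℕ
∑ xs f = sum (map f xs)

private variable A B : Set

∑-++ : ∀ (xs ys : List A) f → ∑ (xs ++ ys) f ≡ ∑ xs f + ∑ ys f
∑-++ xs ys f = trans (cong sum (map-++ f xs ys)) (sum-++ (map f xs) (map f ys))

∑-map : ∀ (g : A → B) xs f → ∑ (map g xs) f ≡ ∑ xs (f ∘ g)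
∑-map g xs f = cong sum (sym (map-∘ xs))

∑-concatMap : ∀ (h : A → List B) xs f → ∑ (concatMap h xs) f ≡ ∑ xs (λ a → ∑ (h a) f)
∑-concatMap h []       f = refl
∑-concatMap h (a ∷ xs) f =
  trans (∑-++ (h a) (concatMap h xs) f) (cong (∑ (h a) f +_) (∑-concatMap h xs f))

∑-cong : ∀ xs {f g : A → ℕ} → (∀ a → f a ≡ g a) → ∑ xs f ≡ ∑ xs g
∑-cong []       f≡g = refl
∑-cong (a ∷ xs) f≡g = cong₂ _+_ (f≡g a) (∑-cong xs f≡g)

∑-mono : ∀ xs {f g : A → ℕ} → (∀ a → f a ≤ g a) → ∑ xs f ≤ ∑ xs g
∑-mono []       f≤g = z≤n
∑-mono (a ∷ xs) f≤g = +-mono-≤ (f≤g a) (∑-mono xs f≤g)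

∑-+ : ∀ xs (f g : A → ℕ) → ∑ xs (λ a → f a + g a) ≡ ∑ xs f + ∑ xs g
∑-+ []       f g = refl
∑-+ (a ∷ xs) f g =
  trans (cong (f a + g a +_) (∑-+ xs f g)) (interchange +-commutativeSemigroup (f a) (g a) (∑ xs f) (∑ xs g))

∑-*ˡ : ∀ xs c (f : A → ℕ) → ∑ xs (λ a → c * f a) ≡ c * ∑ xs f
∑-*ˡ []       c f = sym (*-zeroʳ c)
∑-*ˡ (a ∷ xs) c f =
  trans (cong (c * f a +_) (∑-*ˡ xs c f)) (sym (*-distribˡ-+ c (f a) (∑ xs f)))

∑-const : ∀ (xs : List A) c → ∑ xs (λ _ → c) ≡ length xs * c
∑-const []       c = refl
∑-const (a ∷ xs) c = cong (c +_) (∑-const xs c)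

∑-member : ∀ {xs a} (f : A → ℕ) → a ∈ₗ xs → f a ≤ ∑ xs f
∑-member {xs = a ∷ xs} f (here refl) = m≤m+n (f a) (∑ xs f)
∑-member {xs = b ∷ xs} f (there a∈) = ≤-trans (∑-member f a∈) (m≤n+m (∑ xs f) (f b))

∑-mono-at : ∀ {xs a k} {f g : A → ℕ} → (∀ b → f b ≤ g b) → a ∈ₗ xs → f a + k ≤ g a →
            ∑ xs f + k ≤ ∑ xs g
∑-mono-at {xs = a ∷ xs} {k = k} {f} f≤g (here refl) gap = begin
  f a + ∑ xs f + k   ≡⟨ +-assoc (f a) (∑ xs f) k ⟩
  f a + (∑ xs f + k) ≡⟨ cong (f a +_) (+-comm (∑ xs f) k) ⟩
  f a + (k + ∑ xs f) ≡⟨ +-assoc (f a) k (∑ xs f) ⟨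
  f a + k + ∑ xs f   ≤⟨ +-mono-≤ gap (∑-mono xs f≤g) ⟩
  _                  ∎
  where open ≤-Reasoning
∑-mono-at {xs = b ∷ xs} {k = k} {f} f≤g (there a∈) gap = begin
  f b + ∑ xs f + k   ≡⟨ +-assoc (f b) (∑ xs f) k ⟩
  f b + (∑ xs f + k) ≤⟨ +-mono-≤ (f≤g b) (∑-mono-at f≤g a∈ gap) ⟩
  _                  ∎
  where open ≤-Reasoning

∑-filter : ∀ {P : Pred A 0ℓ} (P? : Decidable P) xs → length (filter P? xs) ≡ ∑ xs (λ a → 𝟙 (does (P? a)))
∑-filter P? []       = refl
∑-filter P? (a ∷ xs) with P? a
... | yes _ = cong suc (∑-filter P? xs)
... | no _  = ∑-filter P? xs

∑-allFin-const : ∀ k c → ∑ (allFin k) (λ _ → c) ≡ k * c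
∑-allFin-const k c = trans (∑-const (allFin k) c) (cong (_* c) (length-tabulate {n = k} (λ i → i)))

∑-allFin-suc : ∀ k (f : Fin (suc k) → ℕ) → ∑ (allFin (suc k)) f ≡ f zero + ∑ (allFin k) (f ∘ Fin.suc)
∑-allFin-suc k f = cong (f zero +_)
  (trans (cong sum (map-tabulate Fin.suc f)) (sym (cong sum (map-tabulate (λ i → i) (f ∘ Fin.suc)))))

∑-point : ∀ {k} (i : Fin k) → ∑ (allFin k) (λ l → 𝟙 (does (i Fin.≟ l))) ≡ 1
∑-point {suc k} zero    = trans (∑-allFin-suc k (λ l → 𝟙 (does (zero Fin.≟ l))))
                                (cong suc (trans (∑-allFin-const k 0) (*-zeroʳ k)))
∑-point {suc k} (suc i) = trans (∑-allFin-suc k (λ l → 𝟙 (does (suc i Fin.≟ l)))) (∑-point i)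

∑-count : ∀ {k} (q : Subset k) → ∑ (allFin k) (λ ℓ → 𝟙 (does (ℓ ∈? q))) ≡ ∣ q ∣
∑-count {zero}  []            = refl
∑-count {suc k} (inside ∷ q)  =
  trans (∑-allFin-suc k (λ ℓ → 𝟙 (does (ℓ ∈? inside ∷ q)))) (cong suc (∑-count q))
∑-count {suc k} (outside ∷ q) =
  trans (∑-allFin-suc k (λ ℓ → 𝟙 (does (ℓ ∈? outside ∷ q)))) (∑-count q)

-- the error indicator of an edge of sign a whose endpoints do (s = true) or do not share a
-- cluster; Defs' isError cl v w unfolds to mismatch (sign v w) (sameᵇ cl v w)
mismatch : Bool → Bool → Bool
mismatch a s = (a ∧ not s) ∨ (not a ∧ s)

-- two vertices of one cluster seen from w (same s): a positive edge of the first is either an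
-- error, or w is in their cluster and the second edge is an error unless it is positive too
agree-bound : ∀ a b s → 𝟙 a ≤ 𝟙 (mismatch a s) + 𝟙 (mismatch b s) + 𝟙 b
agree-bound false b     s     = z≤n
agree-bound true  true  true  = s≤s z≤n
agree-bound true  true  false = s≤s z≤n
agree-bound true  false true  = s≤s z≤n
agree-bound true  false false = s≤s z≤n

-- two vertices of one cluster, positive to a vertex w outside it: both edges are errors
stray-bound : ∀ {a b s} → a ≡ true → b ≡ true → s ≡ false →
              𝟙 a + 2 ≤ 𝟙 (mismatch a s) + 𝟙 (mismatch b s) + 𝟙 b
stray-bound refl refl refl = ≤-refl

-- two vertices of different clusters, both positive to w: w can join at most one of them
split-bound : ∀ {a b} s s′ → a ≡ true → b ≡ true → (T s → T s′ → ⊥) →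
              1 ≤ 𝟙 (mismatch a s) + 𝟙 (mismatch b s′)
split-bound true  true  refl refl apart = ⊥-elim (apart tt tt)
split-bound true  false refl refl apart = s≤s z≤n
split-bound false s′    refl refl apart = s≤s z≤n

⌊⌋-true : ∀ {P : Set} (d : Dec P) → P → ⌊ d ⌋ ≡ true
⌊⌋-true d p = trans (isYes≗does d) (dec-true d p)

⌊⌋-false : ∀ {P : Set} (d : Dec P) → ¬ P → ⌊ d ⌋ ≡ false
⌊⌋-false d ¬p = trans (isYes≗does d) (dec-false d ¬p)

⌊⌋-witness : ∀ {P : Set} (d : Dec P) → ⌊ d ⌋ ≡ true → P
⌊⌋-witness d eq = toWitness (subst T (sym eq) tt)

tolerance-bound : ∀ E m d c N →
  ℤ.+ E ℤ.≤ (ℤ.+ m ℤ.* (ℤ.+ d ℤ.- ℤ.+ 1)) ℤ.+ (ℤ.+ c ℤ.- ℤ.+ 2) ℤ.+ (ℤ.+ N ℤ.- ℤ.+ 3) →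
  E + (m + 5) ≤ m * d + c + N
tolerance-bound E m d c N E≤t =
  ℤP.drop‿+≤+ (subst₂ ℤ._≤_ lhs rhs (ℤP.+-monoˡ-≤ (ℤ.+ m ℤ.+ ℤ.+ 5) E≤t))
  where
  shift : ∀ (M D C K : ℤ) →
    M ℤ.* (D ℤ.- ℤ.+ 1) ℤ.+ (C ℤ.- ℤ.+ 2) ℤ.+ (K ℤ.- ℤ.+ 3) ℤ.+ (M ℤ.+ ℤ.+ 5) ≡ M ℤ.* D ℤ.+ C ℤ.+ K
  shift = ℤSolver.solve-∀
  lhs : ℤ.+ E ℤ.+ (ℤ.+ m ℤ.+ ℤ.+ 5) ≡ ℤ.+ (E + (m + 5))
  lhs = sym (ℤP.pos-+ E (m + 5))
  rhs : _ ≡ ℤ.+ (m * d + c + N)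
  rhs = begin
    _                                   ≡⟨ shift (ℤ.+ m) (ℤ.+ d) (ℤ.+ c) (ℤ.+ N) ⟩
    ℤ.+ m ℤ.* ℤ.+ d ℤ.+ ℤ.+ c ℤ.+ ℤ.+ N ≡⟨ cong (λ t → t ℤ.+ ℤ.+ c ℤ.+ ℤ.+ N) (ℤP.pos-* m d) ⟨
    ℤ.+ (m * d) ℤ.+ ℤ.+ c ℤ.+ ℤ.+ N     ≡⟨ cong (ℤ._+ ℤ.+ N) (ℤP.pos-+ (m * d) c) ⟨
    ℤ.+ (m * d + c) ℤ.+ ℤ.+ N           ≡⟨ ℤP.pos-+ (m * d + c) N ⟨
    ℤ.+ (m * d + c + N)                 ∎
    where open ≡-Reasoning

-- Counting arguments end in a linear inequality that contradicts the tolerance of x_j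
-- (E, F errors at x_j and at a triplet vertex, B block errors, d = d(u_j), c = c(u_j),
-- N = 3n, P = 3p).

-- x_j separated from all its triplet vertices: d blocks cost about m d errors, too many
unjoined-arith : ∀ E B d c N P m → m * d ≤ B + P → B ≤ E → E + (m + 5) ≤ m * d + c + N →
                 c ≤ N → N + N + P ≤ m → ⊥
unjoined-arith E B d c N P m md≤B+P B≤E tol c≤N room =
  m+1+n≰m m (+-cancelˡ-≤ (m * d) (m + 5) m chain)
  where
  open ≤-Reasoning
  swap : ∀ a b c → a + b + (c + 5) ≡ a + (c + 5) + b
  swap = ℕSolver.solve-∀
  regroup : ∀ a c N P → a + c + N + P ≡ a + (c + N + P)
  regroup = ℕSolver.solve-∀
  chain : m * d + (m + 5) ≤ m * d + m
  chain = begin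
    m * d + (m + 5)     ≤⟨ +-monoˡ-≤ (m + 5) (≤-trans md≤B+P (+-monoˡ-≤ P B≤E)) ⟩
    E + P + (m + 5)     ≡⟨ swap E P m ⟩
    E + (m + 5) + P     ≤⟨ +-monoˡ-≤ P tol ⟩
    m * d + c + N + P   ≡⟨ regroup (m * d) c N P ⟩
    m * d + (c + N + P) ≤⟨ +-monoʳ-≤ (m * d) (≤-trans (+-monoˡ-≤ P (+-monoˡ-≤ N c≤N)) room) ⟩
    m * d + m           ∎

-- x_j joined to a triplet vertex but not to a y-vertex of its set: two errors too many
joined-arith : ∀ E F d c N m → c + 1 + (m * d + N) + 2 ≤ E + F + (3 + m) → F ≤ 3 →
               E + (m + 5) ≤ m * d + c + N → ⊥
joined-arith E F d c N m excess F≤3 tol =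
  m+1+n≰m 6 (+-cancelˡ-≤ m 8 6 (+-cancelˡ-≤ (m * d + c + N) (m + 8) (m + 6) chain))
  where
  open ≤-Reasoning
  regroup : ∀ a c N m → a + c + N + (m + 8) ≡ c + 1 + (a + N) + 2 + (m + 5)
  regroup = ℕSolver.solve-∀
  collect : ∀ E m → E + 3 + (3 + m) + (m + 5) ≡ E + (m + 5) + (m + 6)
  collect = ℕSolver.solve-∀
  chain : m * d + c + N + (m + 8) ≤ m * d + c + N + (m + 6)
  chain = begin
    m * d + c + N + (m + 8)         ≡⟨ regroup (m * d) c N m ⟩
    c + 1 + (m * d + N) + 2 + (m + 5) ≤⟨ +-monoˡ-≤ (m + 5) excess ⟩
    E + F + (3 + m) + (m + 5)       ≤⟨ +-monoˡ-≤ (m + 5) (+-monoˡ-≤ (3 + m) (+-monoʳ-≤ E F≤3)) ⟩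
    E + 3 + (3 + m) + (m + 5)       ≡⟨ collect E m ⟩
    E + (m + 5) + (m + 6)           ≤⟨ +-monoˡ-≤ (m + 6) tol ⟩
    m * d + c + N + (m + 6)         ∎

module Analysis (n p m : ℕ) (S : Fin p → Subset (3 * n)) (cl : Construction.Clustering n p m S) where
  open Construction n p m S

  err : V₁ → V₂ → ℕ
  err v w = 𝟙 (isError cl v w)

  posDeg : V₁ → ℕ
  posDeg v = ∑ allV₂ (λ w → 𝟙 (sign v w))

  ySum : (V₂ → ℕ) → ℕ
  ySum f = ∑ (allFin (3 * n)) (f ∘ y)

  block : Fin p → (V₂ → ℕ) → ℕ
  block l f = ∑ (allFin m) (f ∘ yS l)

  zSum : (V₂ → ℕ) → ℕ
  zSum f = ∑ (allFin (3 * n)) (f ∘ z)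

  ∑-V₂ : ∀ f → ∑ allV₂ f ≡ ySum f + (∑ (allFin p) (λ l → block l f) + zSum f)
  ∑-V₂ f =
    trans (∑-++ (map y (allFin (3 * n))) _ f)
      (cong₂ _+_ (∑-map y (allFin (3 * n)) f)
        (trans (∑-++ (concatMap (λ l → map (yS l) (allFin m)) (allFin p)) _ f)
          (cong₂ _+_ (trans (∑-concatMap (λ l → map (yS l) (allFin m)) (allFin p) f)
                            (∑-cong (allFin p) (λ l → ∑-map (yS l) (allFin m) f)))
                     (∑-map z (allFin (3 * n)) f))))

  blocks≤errors : ∀ v → ∑ (allFin p) (λ l → block l (err v)) ≤ errors cl v
  blocks≤errors v = subst (blocks ≤_) (sym (∑-V₂ (err v)))
                          (≤-trans (m≤m+n blocks (zSum (err v))) (m≤n+m _ (ySum (err v))))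
    where
    blocks : ℕ
    blocks = ∑ (allFin p) (λ l → block l (err v))

  block≤errors : ∀ v l → block l (err v) ≤ errors cl v
  block≤errors v l = ≤-trans (∑-member (λ l → block l (err v)) (∈-allFin l)) (blocks≤errors v)

  same-cluster-edge : ∀ {v v′} w → cl (inj₁ v) ≡ cl (inj₁ v′) →
                      𝟙 (sign v w) ≤ err v w + err v′ w + 𝟙 (sign v′ w)
  same-cluster-edge {v} {v′} w joined =
    subst (λ s → 𝟙 (sign v w) ≤ err v w + 𝟙 (mismatch (sign v′ w) s) + 𝟙 (sign v′ w))
          (cong (_≡ᵇ cl (inj₂ w)) joined)
          (agree-bound (sign v w) (sign v′ w) (sameᵇ cl v w))

  stray-edge : ∀ {v v′} w → cl (inj₁ v) ≡ cl (inj₁ v′) → cl (inj₁ v) ≢ cl (inj₂ w) →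
               sign v w ≡ true → sign v′ w ≡ true → 𝟙 (sign v w) + 2 ≤ err v w + err v′ w + 𝟙 (sign v′ w)
  stray-edge {v} {v′} w joined apart +v +v′ =
    subst (λ s → 𝟙 (sign v w) + 2 ≤ err v w + 𝟙 (mismatch (sign v′ w) s) + 𝟙 (sign v′ w))
          (cong (_≡ᵇ cl (inj₂ w)) joined)
          (stray-bound +v +v′ (dec-false (cl (inj₁ v) ≟ cl (inj₂ w)) apart))

  separated-edge : ∀ {v v′} w → cl (inj₁ v) ≢ cl (inj₁ v′) →
                   sign v w ≡ true → sign v′ w ≡ true → 1 ≤ err v w + err v′ w
  separated-edge {v} {v′} w apart +v +v′ =
    split-bound (sameᵇ cl v w) (sameᵇ cl v′ w) +v +v′
      (λ s s′ → apart (trans (≡ᵇ⇒≡ _ _ s) (sym (≡ᵇ⇒≡ _ _ s′))))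

  ∑-blocks : ∀ (g : Fin p → ℕ) → ∑ (allFin p) (λ l → ∑ (allFin m) (λ _ → g l)) ≡ m * ∑ (allFin p) g
  ∑-blocks g = trans (∑-cong (allFin p) (λ l → ∑-allFin-const m (g l))) (∑-*ˡ (allFin p) m g)

  -- x(S_i) is positive exactly to the y_ℓ with u_ℓ ∈ S_i and to its own block
  posDeg-triplet : ∀ i → posDeg (xS i) ≡ ∣ S i ∣ + m
  posDeg-triplet i = begin
    posDeg (xS i)
      ≡⟨ ∑-V₂ (λ w → 𝟙 (sign (xS i) w)) ⟩
    ∑ (allFin (3 * n)) (λ ℓ → 𝟙 ⌊ ℓ ∈? S i ⌋)
      + (∑ (allFin p) (λ l → ∑ (allFin m) (λ _ → 𝟙 ⌊ i Fin.≟ l ⌋)) + zSum (λ _ → 0))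
      ≡⟨ cong₂ _+_ members (cong₂ _+_ own-block (trans (∑-allFin-const (3 * n) 0) (*-zeroʳ (3 * n)))) ⟩
    ∣ S i ∣ + (m * 1 + 0)
      ≡⟨ cong (∣ S i ∣ +_) (trans (+-identityʳ (m * 1)) (*-identityʳ m)) ⟩
    ∣ S i ∣ + m ∎
    where
    open ≡-Reasoning
    members : ∑ (allFin (3 * n)) (λ ℓ → 𝟙 ⌊ ℓ ∈? S i ⌋) ≡ ∣ S i ∣
    members = trans (∑-cong (allFin (3 * n)) (λ ℓ → cong 𝟙 (isYes≗does (ℓ ∈? S i)))) (∑-count (S i))
    own-block : ∑ (allFin p) (λ l → ∑ (allFin m) (λ _ → 𝟙 ⌊ i Fin.≟ l ⌋)) ≡ m * 1
    own-block = trans (∑-blocks (λ l → 𝟙 ⌊ i Fin.≟ l ⌋))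
                  (cong (m *_) (trans (∑-cong (allFin p) (λ l → cong 𝟙 (isYes≗does (i Fin.≟ l))))
                                      (∑-point i)))

  deg-∑ : ∀ j → deg j ≡ ∑ (allFin p) (λ l → 𝟙 (mem j l))
  deg-∑ j = trans (∑-filter (λ l → j ∈? S l) (allFin p))
                  (∑-cong (allFin p) (λ l → cong 𝟙 (sym (isYes≗does (j ∈? S l)))))

  cnb≤ : ∀ j → cnb j ≤ 3 * n
  cnb≤ j = subst (cnb j ≤_) (length-tabulate {n = 3 * n} (λ i → i)) (length-filter _ (allFin (3 * n)))

  -- x_j is positive to y_j and its c(u_j) neighbours, to the d(u_j) blocks of its sets, and to Z;
  -- on the y-vertices, being y_j and being a neighbour are exclusive
  neighbour-split : ∀ j ℓ → 𝟙 (sign (x j) (y ℓ)) ≡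
                    𝟙 (does (¬? (ℓ Fin.≟ j) ×-dec common? j ℓ)) + 𝟙 (does (j Fin.≟ ℓ))
  neighbour-split j ℓ with j Fin.≟ ℓ | ℓ Fin.≟ j
  ... | yes _    | yes _    = refl
  ... | yes j≡ℓ  | no ℓ≢j   = ⊥-elim (ℓ≢j (sym j≡ℓ))
  ... | no j≢ℓ   | yes ℓ≡j  = ⊥-elim (j≢ℓ (sym ℓ≡j))
  ... | no _     | no _     = trans (cong 𝟙 (isYes≗does (common? j ℓ))) (sym (+-identityʳ _))

  posDeg-ground : ∀ j → posDeg (x j) ≡ cnb j + 1 + (m * deg j + 3 * n)
  posDeg-ground j = begin
    posDeg (x j)
      ≡⟨ ∑-V₂ (λ w → 𝟙 (sign (x j) w)) ⟩
    ySum (λ w → 𝟙 (sign (x j) w))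
      + (∑ (allFin p) (λ l → ∑ (allFin m) (λ _ → 𝟙 (mem j l))) + zSum (λ _ → 1))
      ≡⟨ cong₂ _+_ neighbours
                   (cong₂ _+_ own-blocks (trans (∑-allFin-const (3 * n) 1) (*-identityʳ (3 * n)))) ⟩
    cnb j + 1 + (m * deg j + 3 * n) ∎
    where
    open ≡-Reasoning
    neighbours : ySum (λ w → 𝟙 (sign (x j) w)) ≡ cnb j + 1
    neighbours = begin
      ySum (λ w → 𝟙 (sign (x j) w))
        ≡⟨ ∑-cong (allFin (3 * n)) (neighbour-split j) ⟩
      ∑ (allFin (3 * n)) (λ ℓ → 𝟙 (does (¬? (ℓ Fin.≟ j) ×-dec common? j ℓ)) + 𝟙 (does (j Fin.≟ ℓ)))
        ≡⟨ ∑-+ (allFin (3 * n)) _ _ ⟩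
      ∑ (allFin (3 * n)) (λ ℓ → 𝟙 (does (¬? (ℓ Fin.≟ j) ×-dec common? j ℓ)))
        + ∑ (allFin (3 * n)) (λ ℓ → 𝟙 (does (j Fin.≟ ℓ)))
        ≡⟨ cong₂ _+_ (sym (∑-filter (λ ℓ → ¬? (ℓ Fin.≟ j) ×-dec common? j ℓ) (allFin (3 * n))))
                     (∑-point j) ⟩
      cnb j + 1 ∎
    own-blocks : ∑ (allFin p) (λ l → ∑ (allFin m) (λ _ → 𝟙 (mem j l))) ≡ m * deg j
    own-blocks = trans (∑-blocks (λ l → 𝟙 (mem j l))) (cong (m *_) (sym (deg-∑ j)))

  stray-neighbour : ∀ {v v′} w → w ∈ₗ allV₂ → cl (inj₁ v) ≡ cl (inj₁ v′) → cl (inj₁ v) ≢ cl (inj₂ w) →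
                    sign v w ≡ true → sign v′ w ≡ true →
                    posDeg v + 2 ≤ errors cl v + errors cl v′ + posDeg v′
  stray-neighbour {v} {v′} w w∈ joined apart +v +v′ =
    ≤-trans (∑-mono-at (λ w′ → same-cluster-edge w′ joined) w∈ (stray-edge w joined apart +v +v′))
            (≤-reflexive (trans (∑-+ allV₂ _ _) (cong (_+ posDeg v′) (∑-+ allV₂ (err v) (err v′)))))

  module Perfect (perfect : OneSidedPerfect cl) where

    triplet-errors : ∀ i → errors cl (xS i) ≤ 3
    triplet-errors i = ℤP.drop‿+≤+ (perfect (xS i))

    ground-errors : ∀ j → errors cl (x j) + (m + 5) ≤ m * deg j + cnb j + 3 * n
    ground-errors j = tolerance-bound (errors cl (x j)) m (deg j) (cnb j) (3 * n) (perfect (x j))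

    -- distinct triplet vertices lie in distinct clusters: otherwise every vertex of the
    -- block of one of them has an error edge to one of the two
    triplets-apart : 7 ≤ m → ∀ i i′ → cl (inj₁ (xS i′)) ≡ cl (inj₁ (xS i)) → i′ ≡ i
    triplets-apart 7≤m i i′ joined with i′ Fin.≟ i
    ... | yes i′≡i = i′≡i
    ... | no  i′≢i = ⊥-elim (<⇒≱ 7≤m m≤6)
      where
      open ≤-Reasoning
      disagree : ∀ k → 1 ≤ err (xS i) (yS i k) + err (xS i′) (yS i k)
      disagree k =
        ≤-trans (subst₂ (λ a b → 𝟙 a ≤ err (xS i) (yS i k) + err (xS i′) (yS i k) + 𝟙 b)
                        (⌊⌋-true (i Fin.≟ i) refl) (⌊⌋-false (i′ Fin.≟ i) i′≢i)
                        (same-cluster-edge (yS i k) (sym joined)))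
                (≤-reflexive (+-identityʳ _))
      m≤6 : m ≤ 6
      m≤6 = begin
        m                                                              ≡⟨ *-identityʳ m ⟨
        m * 1                                                          ≡⟨ ∑-allFin-const m 1 ⟨
        ∑ (allFin m) (λ _ → 1)                                         ≤⟨ ∑-mono (allFin m) disagree ⟩
        ∑ (allFin m) (λ k → err (xS i) (yS i k) + err (xS i′) (yS i k)) ≡⟨ ∑-+ (allFin m) _ _ ⟩
        block i (err (xS i)) + block i (err (xS i′))
          ≤⟨ +-mono-≤ (≤-trans (block≤errors (xS i) i) (triplet-errors i))
                      (≤-trans (block≤errors (xS i′) i) (triplet-errors i′)) ⟩
        6                                                              ∎

    -- a block of a set containing u_j whose triplet vertex is not in the cluster of x_j
    -- costs x_j about m errors: each y_k(S_l) is positive to both and joins at most one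
    block-cost : ∀ j l → (j ∈ S l → cl (inj₁ (x j)) ≢ cl (inj₁ (xS l))) →
                 m * 𝟙 (mem j l) ≤ block l (err (x j)) + 3
    block-cost j l apart = cost (mem j l) refl
      where
      open ≤-Reasoning
      cost : ∀ b → mem j l ≡ b → m * 𝟙 b ≤ block l (err (x j)) + 3
      cost false _      = ≤-trans (≤-reflexive (*-zeroʳ m)) z≤n
      cost true  member = begin
        m * 1                                                         ≡⟨ ∑-allFin-const m 1 ⟨
        ∑ (allFin m) (λ _ → 1)
          ≤⟨ ∑-mono (allFin m) (λ k → separated-edge (yS l k) (apart (⌊⌋-witness (j ∈? S l) member))
                                                     member (⌊⌋-true (l Fin.≟ l) refl)) ⟩
        ∑ (allFin m) (λ k → err (x j) (yS l k) + err (xS l) (yS l k)) ≡⟨ ∑-+ (allFin m) _ _ ⟩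
        block l (err (x j)) + block l (err (xS l))
          ≤⟨ +-monoʳ-≤ (block l (err (x j))) (≤-trans (block≤errors (xS l) l) (triplet-errors l)) ⟩
        block l (err (x j)) + 3                                       ∎

    ground-joins-triplet : 6 * n + 3 * p ≤ m → ∀ j →
                           Σ (Fin p) λ l → j ∈ S l × cl (inj₁ (x j)) ≡ cl (inj₁ (xS l))
    ground-joins-triplet room j with any? (λ l → (j ∈? S l) ×-dec (cl (inj₁ (x j)) ≟ cl (inj₁ (xS l))))
    ... | yes joined = joined
    ... | no  none   = ⊥-elim (unjoined-arith (errors cl (x j)) blocks (deg j) (cnb j) (3 * n) (p * 3) m
                                cost (blocks≤errors (x j)) (ground-errors j) (cnb≤ j) room′)
      where
      open ≤-Reasoning
      blocks : ℕ
      blocks = ∑ (allFin p) (λ l → block l (err (x j)))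
      cost : m * deg j ≤ blocks + p * 3
      cost = begin
        m * deg j                                        ≡⟨ cong (m *_) (deg-∑ j) ⟩
        m * ∑ (allFin p) (λ l → 𝟙 (mem j l))             ≡⟨ ∑-*ˡ (allFin p) m _ ⟨
        ∑ (allFin p) (λ l → m * 𝟙 (mem j l))
          ≤⟨ ∑-mono (allFin p) (λ l → block-cost j l (λ j∈ joined → none (l , j∈ , joined))) ⟩
        ∑ (allFin p) (λ l → block l (err (x j)) + 3)     ≡⟨ ∑-+ (allFin p) _ _ ⟩
        blocks + ∑ (allFin p) (λ _ → 3)                  ≡⟨ cong (blocks +_) (∑-allFin-const p 3) ⟩
        blocks + p * 3                                   ∎
      room′ : 3 * n + 3 * n + p * 3 ≤ m
      room′ = subst (_≤ m) (split-room n p) room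
        where
        split-room : ∀ a b → 6 * a + 3 * b ≡ 3 * a + 3 * a + b * 3
        split-room = ℕSolver.solve-∀

    -- if x_j shares the cluster of x(S_i) with u_j ∈ S_i, then so does every y_ℓ with u_ℓ ∈ S_i:
    -- a y_ℓ outside the cluster raises the error count of x_j two above its tolerance
    triple-joins : ∀ i j ℓ → ∣ S i ∣ ≡ 3 → j ∈ S i → ℓ ∈ S i →
                   cl (inj₁ (x j)) ≡ cl (inj₁ (xS i)) → cl (inj₁ (x j)) ≡ cl (inj₂ (y ℓ))
    triple-joins i j ℓ size j∈ ℓ∈ joined with cl (inj₁ (x j)) ≟ cl (inj₂ (y ℓ))
    ... | yes same  = same
    ... | no  apart = ⊥-elim (joined-arith (errors cl (x j)) (errors cl (xS i)) (deg j) (cnb j) (3 * n) m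
                                excess (triplet-errors i) (ground-errors j))
      where
      +xj : sign (x j) (y ℓ) ≡ true
      +xj = trans (cong (⌊ j Fin.≟ ℓ ⌋ ∨_) (⌊⌋-true (common? j ℓ) (i , j∈ , ℓ∈))) (∨-zeroʳ _)
      excess : cnb j + 1 + (m * deg j + 3 * n) + 2 ≤ errors cl (x j) + errors cl (xS i) + (3 + m)
      excess = subst₂ (λ a b → a + 2 ≤ errors cl (x j) + errors cl (xS i) + b)
                      (posDeg-ground j) (trans (posDeg-triplet i) (cong (_+ m) size))
                      (stray-neighbour (y ℓ) (∈-++⁺ˡ (∈-map⁺ y (∈-allFin ℓ))) joined apart
                                       +xj (⌊⌋-true (ℓ ∈? S i) ℓ∈))

-- Lemma 4: the triplet vertex is found by (b), unique by (a), and its set joins x_j by (c).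
lemma4 : (n p m : ℕ) → n ≥ 1 → p ≥ 1 → m ≥ 6 * n + 3 * p →
    (S : Fin p → Subset (3 * n)) → (∀ i → ∣ S i ∣ ≡ 3) → Injective _≡_ _≡_ S →
    (cl : Construction.Clustering n p m S) → Construction.OneSidedPerfect n p m S cl →
    (j : Fin (3 * n)) →
    Σ (Fin p) λ i →
      (cl (inj₁ (Construction.x j)) ≡ cl (inj₁ (Construction.xS i)))
      × (∀ i′ → cl (inj₁ (Construction.x j)) ≡ cl (inj₁ (Construction.xS i′)) → i′ ≡ i)
      × j ∈ S i
      × (∀ ℓ → ℓ ∈ S i → cl (inj₁ (Construction.x j)) ≡ cl (inj₂ (Construction.y ℓ)))
lemma4 n p m n≥1 p≥1 room S size _ cl perfect j =
  i , joined , unique , j∈ , (λ ℓ ℓ∈ → triple-joins i j ℓ (size i) j∈ ℓ∈ joined)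
  where
  open Analysis n p m S cl
  open Perfect perfect
  found : Σ (Fin p) λ l → j ∈ S l × cl (inj₁ (Construction.x j)) ≡ cl (inj₁ (Construction.xS l))
  found = ground-joins-triplet room j
  i : Fin p
  i = proj₁ found
  j∈ : j ∈ S i
  j∈ = proj₁ (proj₂ found)
  joined : cl (inj₁ (Construction.x j)) ≡ cl (inj₁ (Construction.xS i))
  joined = proj₂ (proj₂ found)
  7≤m : 7 ≤ m
  7≤m = ≤-trans (m≤m+n 7 2) (≤-trans (+-mono-≤ (*-monoʳ-≤ 6 n≥1) (*-monoʳ-≤ 3 p≥1)) room)
  unique : ∀ i′ → cl (inj₁ (Construction.x j)) ≡ cl (inj₁ (Construction.xS i′)) → i′ ≡ i
  unique i′ joined′ = triplets-apart 7≤m i i′ (trans (sym joined′) joined)
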